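{- Let $D$ be a block design with parameters $(v,b,r,k,\lambda)$ built on a finite set $V$. Then $D$ is friends with itself, i.e. the partition $\varphi(D,B)$ does not depend on the choice of the block $B$ of $D$, in each of the following cases: (1) $\lambda=1$; (2) $k=3$; (3) $D$ is symmetric, i.e. $b=v$.
   Context: A block design with parameters $(v,b,r,k,\lambda)$ built on a finite set $V$ ($|V|=v$) is a list of $b$ blocks, each a $k$-subset of $V$, such that every element lies in exactly $r$ blocks and every pair of distinct elements lies in exactly $\lambda$ blocks; designs are simple (no repeated blocks). For a design $D$ with blocks $B_1,\dots,B_b$ and $M\subseteq V$, $\varphi(D,M)=(z_0,\dots,z_k)$ where $z_j$ is the number of $s$ with $|M\cap B_s|=j$. Two designs $D_1,D_2$ on $V$ are friends if $\varphi(D_1,D_2^i)$ is independent of the block $D_2^i$ of $D_2$ and $\varphi(D_2,D_1^j)$ is independent of the block $D_1^j$ of $D_1$; $D$ is friends with itself when this holds with $D_1=D_2=D$. -}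

module Defs where

open import Data.Nat using (ℕ; zero; suc; _+_; _≡ᵇ_)
open import Data.Bool using (Bool; true; false; _∧_)
open import Data.Fin using (Fin; zero; suc; toℕ)
open import Data.Fin.Subset using (Subset; _∈_; _∩_; ∣_∣)
open import Data.Fin.Subset.Properties using (_∈?_)
open import Relation.Nullary using (does)
open import Relation.Binary.PropositionalEquality using (_≡_; _≢_)
open import Function.Definitions using (Injective)

count : ∀ {n} → (Fin n → Bool) → ℕ
count {zero} p = 0
count {suc n} p with p zero
... | true  = suc (count (λ i → p (suc i)))
... | false = count (λ i → p (suc i))

_∈ᵇ_ : ∀ {v} → Fin v → Subset v → Bool
x ∈ᵇ S = does (x ∈? S)

record BlockDesign (v b r k lam : ℕ) : Set where
  field
    block       : Fin b → Subset v
    simple      : Injective _≡_ _≡_ block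
    blockSize   : ∀ s → ∣ block s ∣ ≡ k
    replication : ∀ (x : Fin v) → count (λ s → x ∈ᵇ block s) ≡ r
    balance     : ∀ (x y : Fin v) → x ≢ y →
                  count (λ s → (x ∈ᵇ block s) ∧ (y ∈ᵇ block s)) ≡ lam

open BlockDesign public

φ : ∀ {v b r k lam} → BlockDesign v b r k lam → Subset v → Fin (suc k) → ℕ
φ D M j = count (λ s → ∣ M ∩ block D s ∣ ≡ᵇ toℕ j)

SelfFriend : ∀ {v b r k lam} → BlockDesign v b r k lam → Set
SelfFriend {b = b} {k = k} D =
  ∀ (s t : Fin b) (j : Fin (suc k)) → φ D (block D s) j ≡ φ D (block D t) j

module Submission where

-- Fix a block B of a design D with b = 1 + n blocks and list the
-- sizes |B ∩ B'| over the n other blocks B' (the "intersection profile" of B);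
-- φ(D,B) is the value distribution of this profile, plus one for B itself.
-- Double counting incidences gives, for every M ⊆ V, the two moment identities
--   Σ_s |M ∩ B_s| = |M| r,    Σ_s |M ∩ B_s|² + |M| λ = |M|² λ + |M| r,
-- so the sum and the sum of squares of the profile do not depend on B.
--   * If every profile entry is at most 2, the value distribution is determined
--     by these two moments (and n), since the system with rows (1,1,1),
--     (0,1,2), (0,1,4) is invertible; λ = 1 (profile sums equal square sums,
--     forcing entries in {0,1}) and k = 3 (an intersection of size 3 would
--     make two blocks equal, contradicting simplicity) fall under this case.
--   * If b = v, the moments with M = V give k = r and k² = nλ + k, hence
--     Σ h = nλ and Σ h² = nλ²; equality in 2λh ≤ h² + λ² forces h = λ, so the
--     profile is constant.

open import Defs
open import Data.Nat
open import Data.Nat.Properties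
open import Algebra.Properties.Semiring.Sum +-*-semiring
  using (sum; sum-syntax; sum-cong-≗; ∑-distrib-+; ∑-comm; *-distribˡ-sum; *-distribʳ-sum; sum-remove)
open import Data.Nat.Tactic.RingSolver using (solve-∀)
open import Data.Bool using (Bool; true; false; _∧_)
open import Data.Bool.Properties using (∧-idem)
open import Data.Fin using (Fin; zero; suc; punchIn; toℕ)
open import Data.Fin.Properties using (punchInᵢ≢i)
open import Data.Fin.Subset using (Subset; _∩_; _⊆_; ∣_∣; inside; outside; ⊤)
open import Data.Fin.Subset.Properties
  using (∩-idem; ∩-identityˡ; ∣⊤∣≡n; drop-∷-⊆; p⊆q⇒∣p∣≤∣q∣; p∩q⊆p; p∩q⊆q; ∣p∩q∣≤∣q∣)
open import Data.Vec using ([]; _∷_; here)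
open import Data.Product using (_×_; _,_; proj₁; proj₂)
open import Data.Sum using (_⊎_; inj₁; inj₂; reduce)
open import Data.Empty using (⊥-elim)
open import Function using (_∘_)
open import Relation.Binary.PropositionalEquality
open ≡-Reasoning

𝟙 : Bool → ℕ
𝟙 true  = 1
𝟙 false = 0

𝟙-∧ : ∀ a b → 𝟙 (a ∧ b) ≡ 𝟙 a * 𝟙 b
𝟙-∧ true  b = sym (+-identityʳ (𝟙 b))
𝟙-∧ false b = refl

𝟙-absorb : ∀ a u → 𝟙 a * (𝟙 a * u) ≡ 𝟙 a * u
𝟙-absorb true  u = *-identityˡ (1 * u)
𝟙-absorb false u = refl

count≡sum : ∀ {n} (p : Fin n → Bool) → count p ≡ ∑[ i < n ] 𝟙 (p i)
count≡sum {zero}  p = refl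
count≡sum {suc n} p with p zero
... | true  = cong suc (count≡sum (p ∘ suc))
... | false = count≡sum (p ∘ suc)

count-cong : ∀ {n} {p q : Fin n → Bool} → (∀ i → p i ≡ q i) → count p ≡ count q
count-cong {p = p} {q} p≗q =
  trans (count≡sum p) (trans (sum-cong-≗ (cong 𝟙 ∘ p≗q)) (sym (count≡sum q)))

sum-const : ∀ n c → ∑[ i < n ] c ≡ n * c
sum-const zero    c = refl
sum-const (suc n) c = cong (c +_) (sum-const n c)

sum-*-sum : ∀ {m n} (f : Fin m → ℕ) (g : Fin n → ℕ) →
            sum f * sum g ≡ ∑[ i < m ] ∑[ j < n ] (f i * g j)
sum-*-sum f g = trans (*-distribʳ-sum (sum g) f) (sum-cong-≗ (λ i → *-distribˡ-sum (f i) g))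

sum-mono-≤ : ∀ {n} {f g : Fin n → ℕ} → (∀ i → f i ≤ g i) → sum f ≤ sum g
sum-mono-≤ {zero}  f≤g = z≤n
sum-mono-≤ {suc n} f≤g = +-mono-≤ (f≤g zero) (sum-mono-≤ (f≤g ∘ suc))

sum-mono-≡ : ∀ {n} {f g : Fin n → ℕ} → (∀ i → f i ≤ g i) → sum f ≡ sum g → ∀ i → f i ≡ g i
sum-mono-≡ {suc n} {f} {g} f≤g Σf≡Σg = λ where
    zero    → head≡
    (suc i) → sum-mono-≡ (f≤g ∘ suc) (+-cancelˡ-≡ (f zero) _ _ (trans Σf≡Σg (cong (_+ _) (sym head≡)))) i
  where
  head≡ : f zero ≡ g zero
  head≡ = ≤-antisym (f≤g zero) (+-cancelʳ-≤ (sum (g ∘ suc)) (g zero) (f zero)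
            (≤-trans (≤-reflexive (sym Σf≡Σg)) (+-monoʳ-≤ (f zero) (sum-mono-≤ (f≤g ∘ suc)))))

sum-exchange : ∀ {n} (f g : Fin n → ℕ) (x : Fin n) →
               (∀ y → y ≢ x → f y ≡ g y) → sum f + g x ≡ sum g + f x
sum-exchange {suc n} f g x agree = begin
  sum f + g x                            ≡⟨ cong (_+ g x) (sum-remove {i = x} f) ⟩
  f x + sum (f ∘ punchIn x) + g x        ≡⟨ cong (λ t → f x + t + g x) (sum-cong-≗ agree′) ⟩
  f x + sum (g ∘ punchIn x) + g x        ≡⟨ swap (f x) _ (g x) ⟩
  g x + sum (g ∘ punchIn x) + f x        ≡⟨ cong (_+ f x) (sym (sum-remove {i = x} g)) ⟩
  sum g + f x                            ∎
  where
  agree′ : ∀ i → f (punchIn x i) ≡ g (punchIn x i)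
  agree′ i = agree (punchIn x i) (punchInᵢ≢i x i)
  swap : ∀ a b c → a + b + c ≡ c + b + a
  swap = solve-∀

∣∣≡sum : ∀ {n} (A : Subset n) → ∣ A ∣ ≡ ∑[ x < n ] 𝟙 (x ∈ᵇ A)
∣∣≡sum []           = refl
∣∣≡sum (inside ∷ A)  = cong suc (∣∣≡sum A)
∣∣≡sum (outside ∷ A) = ∣∣≡sum A

∈ᵇ-∩ : ∀ {n} (x : Fin n) (A B : Subset n) → x ∈ᵇ (A ∩ B) ≡ (x ∈ᵇ A) ∧ (x ∈ᵇ B)
∈ᵇ-∩ zero    (inside ∷ A)  (inside ∷ B)  = refl
∈ᵇ-∩ zero    (inside ∷ A)  (outside ∷ B) = refl
∈ᵇ-∩ zero    (outside ∷ A) (b ∷ B)       = refl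
∈ᵇ-∩ (suc x) (a ∷ A)       (b ∷ B)       = ∈ᵇ-∩ x A B

∣∩∣≡sum : ∀ {n} (A B : Subset n) → ∣ A ∩ B ∣ ≡ ∑[ x < n ] (𝟙 (x ∈ᵇ A) * 𝟙 (x ∈ᵇ B))
∣∩∣≡sum A B = trans (∣∣≡sum (A ∩ B))
  (sum-cong-≗ (λ x → trans (cong 𝟙 (∈ᵇ-∩ x A B)) (𝟙-∧ (x ∈ᵇ A) (x ∈ᵇ B))))

sum-over : ∀ {n} (A : Subset n) (c : ℕ) → ∑[ x < n ] (𝟙 (x ∈ᵇ A) * c) ≡ ∣ A ∣ * c
sum-over A c = trans (sym (*-distribʳ-sum c (λ x → 𝟙 (x ∈ᵇ A)))) (cong (_* c) (sym (∣∣≡sum A)))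

⊆-∣≡∣⇒≡ : ∀ {n} {p q : Subset n} → p ⊆ q → ∣ p ∣ ≡ ∣ q ∣ → p ≡ q
⊆-∣≡∣⇒≡ {p = []}          {[]}          _   _    = refl
⊆-∣≡∣⇒≡ {p = inside ∷ p}  {inside ∷ q}  p⊆q size = cong (inside ∷_) (⊆-∣≡∣⇒≡ (drop-∷-⊆ p⊆q) (suc-injective size))
⊆-∣≡∣⇒≡ {p = outside ∷ p} {outside ∷ q} p⊆q size = cong (outside ∷_) (⊆-∣≡∣⇒≡ (drop-∷-⊆ p⊆q) size)
⊆-∣≡∣⇒≡ {p = inside ∷ p}  {outside ∷ q} p⊆q size with p⊆q here
... | ()
⊆-∣≡∣⇒≡ {p = outside ∷ p} {inside ∷ q}  p⊆q size =
  ⊥-elim (<-irrefl size (s≤s (p⊆q⇒∣p∣≤∣q∣ (drop-∷-⊆ p⊆q))))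

module DoubleCounting {v b : ℕ} (B : Fin b → Subset v) where

  degree : Fin v → ℕ
  degree x = count (λ s → x ∈ᵇ B s)

  codegree : Fin v → Fin v → ℕ
  codegree x y = count (λ s → (x ∈ᵇ B s) ∧ (y ∈ᵇ B s))

  incidence : Fin v → Fin b → ℕ
  incidence x s = 𝟙 (x ∈ᵇ B s)

  codegree≡sum : ∀ x y → codegree x y ≡ ∑[ s < b ] (incidence x s * incidence y s)
  codegree≡sum x y = trans (count≡sum (λ s → (x ∈ᵇ B s) ∧ (y ∈ᵇ B s)))
                           (sum-cong-≗ (λ s → 𝟙-∧ (x ∈ᵇ B s) (y ∈ᵇ B s)))

  first-moment : ∀ M → ∑[ s < b ] ∣ M ∩ B s ∣ ≡ ∑[ x < v ] (𝟙 (x ∈ᵇ M) * degree x)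
  first-moment M = begin
    ∑[ s < b ] ∣ M ∩ B s ∣                          ≡⟨ sum-cong-≗ (λ s → ∣∩∣≡sum M (B s)) ⟩
    ∑[ s < b ] ∑[ x < v ] (a x * incidence x s)      ≡⟨ ∑-comm (λ s x → a x * incidence x s) ⟩
    ∑[ x < v ] ∑[ s < b ] (a x * incidence x s)      ≡⟨ sum-cong-≗ (λ x → sym (*-distribˡ-sum (a x) (incidence x))) ⟩
    ∑[ x < v ] (a x * sum (incidence x))             ≡⟨ sum-cong-≗ (λ x → cong (a x *_) (sym (count≡sum (λ s → x ∈ᵇ B s)))) ⟩
    ∑[ x < v ] (a x * degree x)                      ∎
    where
    a : Fin v → ℕ
    a x = 𝟙 (x ∈ᵇ M)

  second-moment : ∀ M → ∑[ s < b ] (∣ M ∩ B s ∣ * ∣ M ∩ B s ∣)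
                      ≡ ∑[ x < v ] (𝟙 (x ∈ᵇ M) * ∑[ y < v ] (𝟙 (y ∈ᵇ M) * codegree x y))
  second-moment M = begin
    ∑[ s < b ] (∣ M ∩ B s ∣ * ∣ M ∩ B s ∣)
      ≡⟨ sum-cong-≗ (λ s → cong₂ _*_ (∣∩∣≡sum M (B s)) (∣∩∣≡sum M (B s))) ⟩
    ∑[ s < b ] (∑[ x < v ] A x s * ∑[ y < v ] A y s)
      ≡⟨ sum-cong-≗ (λ s → sum-*-sum (λ x → A x s) (λ y → A y s)) ⟩
    ∑[ s < b ] ∑[ x < v ] ∑[ y < v ] (A x s * A y s)
      ≡⟨ ∑-comm (λ s x → ∑[ y < v ] (A x s * A y s)) ⟩
    ∑[ x < v ] ∑[ s < b ] ∑[ y < v ] (A x s * A y s)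
      ≡⟨ sum-cong-≗ (λ x → ∑-comm (λ s y → A x s * A y s)) ⟩
    ∑[ x < v ] ∑[ y < v ] ∑[ s < b ] (A x s * A y s)
      ≡⟨ sum-cong-≗ (λ x → sum-cong-≗ (λ y → pair-count x y)) ⟩
    ∑[ x < v ] ∑[ y < v ] (a x * (a y * codegree x y))
      ≡⟨ sum-cong-≗ (λ x → sym (*-distribˡ-sum (a x) (λ y → a y * codegree x y))) ⟩
    ∑[ x < v ] (a x * ∑[ y < v ] (a y * codegree x y)) ∎
    where
    a : Fin v → ℕ
    a x = 𝟙 (x ∈ᵇ M)
    A : Fin v → Fin b → ℕ
    A x s = a x * incidence x s
    regroup : ∀ p q u w → (p * q) * (u * w) ≡ p * (u * (q * w))
    regroup = solve-∀
    pair-count : ∀ x y → ∑[ s < b ] (A x s * A y s) ≡ a x * (a y * codegree x y)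
    pair-count x y = begin
      ∑[ s < b ] (A x s * A y s)
        ≡⟨ sum-cong-≗ (λ s → regroup (a x) (incidence x s) (a y) (incidence y s)) ⟩
      ∑[ s < b ] (a x * (a y * (incidence x s * incidence y s)))
        ≡⟨ sym (*-distribˡ-sum (a x) (λ s → a y * (incidence x s * incidence y s))) ⟩
      a x * ∑[ s < b ] (a y * (incidence x s * incidence y s))
        ≡⟨ cong (a x *_) (sym (*-distribˡ-sum (a y) (λ s → incidence x s * incidence y s))) ⟩
      a x * (a y * ∑[ s < b ] (incidence x s * incidence y s))
        ≡⟨ cong (λ t → a x * (a y * t)) (sym (codegree≡sum x y)) ⟩
      a x * (a y * codegree x y) ∎

-- In a 2-design every point has degree r and every pair of distinct points
-- codegree λ, so the moments of |M ∩ B_s| depend only on |M|.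
module DesignMoments {v b r k lam : ℕ} (D : BlockDesign v b r k lam) where
  open DoubleCounting (block D)

  codegree-diagonal : ∀ x → codegree x x ≡ r
  codegree-diagonal x = trans (count-cong (λ s → ∧-idem (x ∈ᵇ block D s))) (replication D x)

  moment₁ : ∀ M → ∑[ s < b ] ∣ M ∩ block D s ∣ ≡ ∣ M ∣ * r
  moment₁ M = trans (first-moment M)
    (trans (sum-cong-≗ (λ x → cong (𝟙 (x ∈ᵇ M) *_) (replication D x))) (sum-over M r))

  codegree-row : ∀ M x → ∑[ y < v ] (𝟙 (y ∈ᵇ M) * codegree x y) + 𝟙 (x ∈ᵇ M) * lam
                         ≡ ∣ M ∣ * lam + 𝟙 (x ∈ᵇ M) * r
  codegree-row M x = begin
    ∑[ y < v ] (a y * codegree x y) + a x * lam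
      ≡⟨ sum-exchange (λ y → a y * codegree x y) (λ y → a y * lam) x off-diagonal ⟩
    ∑[ y < v ] (a y * lam) + a x * codegree x x
      ≡⟨ cong₂ _+_ (sum-over M lam) (cong (a x *_) (codegree-diagonal x)) ⟩
    ∣ M ∣ * lam + a x * r ∎
    where
    a : Fin v → ℕ
    a y = 𝟙 (y ∈ᵇ M)
    off-diagonal : ∀ y → y ≢ x → a y * codegree x y ≡ a y * lam
    off-diagonal y y≢x = cong (a y *_) (balance D x y (λ x≡y → y≢x (sym x≡y)))

  moment₂ : ∀ M → ∑[ s < b ] (∣ M ∩ block D s ∣ * ∣ M ∩ block D s ∣) + ∣ M ∣ * lam
                  ≡ ∣ M ∣ * ∣ M ∣ * lam + ∣ M ∣ * r
  moment₂ M = begin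
    ∑[ s < b ] (∣ M ∩ block D s ∣ * ∣ M ∩ block D s ∣) + m * lam
      ≡⟨ cong₂ _+_ (second-moment M) (sym (sum-over M lam)) ⟩
    ∑[ x < v ] (a x * T x) + ∑[ x < v ] (a x * lam)
      ≡⟨ sym (∑-distrib-+ (λ x → a x * T x) (λ x → a x * lam)) ⟩
    ∑[ x < v ] (a x * T x + a x * lam)
      ≡⟨ sum-cong-≗ weighted-row ⟩
    ∑[ x < v ] (a x * (m * lam) + a x * r)
      ≡⟨ ∑-distrib-+ (λ x → a x * (m * lam)) (λ x → a x * r) ⟩
    ∑[ x < v ] (a x * (m * lam)) + ∑[ x < v ] (a x * r)
      ≡⟨ cong₂ _+_ (sum-over M (m * lam)) (sum-over M r) ⟩
    m * (m * lam) + m * r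
      ≡⟨ cong (_+ m * r) (sym (*-assoc m m lam)) ⟩
    m * m * lam + m * r ∎
    where
    m : ℕ
    m = ∣ M ∣
    a : Fin v → ℕ
    a x = 𝟙 (x ∈ᵇ M)
    T : Fin v → ℕ
    T x = ∑[ y < v ] (a y * codegree x y)
    weighted-row : ∀ x → a x * T x + a x * lam ≡ a x * (m * lam) + a x * r
    weighted-row x = begin
      a x * T x + a x * lam           ≡⟨ cong (a x * T x +_) (sym (𝟙-absorb (x ∈ᵇ M) lam)) ⟩
      a x * T x + a x * (a x * lam)   ≡⟨ sym (*-distribˡ-+ (a x) (T x) (a x * lam)) ⟩
      a x * (T x + a x * lam)         ≡⟨ cong (a x *_) (codegree-row M x) ⟩
      a x * (m * lam + a x * r)       ≡⟨ *-distribˡ-+ (a x) (m * lam) (a x * r) ⟩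
      a x * (m * lam) + a x * (a x * r) ≡⟨ cong (a x * (m * lam) +_) (𝟙-absorb (x ∈ᵇ M) r) ⟩
      a x * (m * lam) + a x * r       ∎

mult : ∀ {n} → (Fin n → ℕ) → ℕ → ℕ
mult h j = count (λ i → h i ≡ᵇ j)

value-split : ∀ (F : ℕ → ℕ) a → a ≤ 2 →
              F a ≡ F 0 * 𝟙 (a ≡ᵇ 0) + F 1 * 𝟙 (a ≡ᵇ 1) + F 2 * 𝟙 (a ≡ᵇ 2)
value-split F 0 _ = at₀ (F 0) (F 1) (F 2)
  where
  at₀ : ∀ p q u → p ≡ p * 1 + q * 0 + u * 0
  at₀ = solve-∀
value-split F 1 _ = at₁ (F 0) (F 1) (F 2)
  where
  at₁ : ∀ p q u → q ≡ p * 0 + q * 1 + u * 0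
  at₁ = solve-∀
value-split F 2 _ = at₂ (F 0) (F 1) (F 2)
  where
  at₂ : ∀ p q u → u ≡ p * 0 + q * 0 + u * 1
  at₂ = solve-∀
value-split F (suc (suc (suc a))) (s≤s (s≤s ()))

sum-by-values : ∀ {n} (F : ℕ → ℕ) (h : Fin n → ℕ) → (∀ i → h i ≤ 2) →
                ∑[ i < n ] F (h i) ≡ F 0 * mult h 0 + F 1 * mult h 1 + F 2 * mult h 2
sum-by-values {n} F h h≤2 = begin
  ∑[ i < n ] F (h i)
    ≡⟨ sum-cong-≗ (λ i → value-split F (h i) (h≤2 i)) ⟩
  ∑[ i < n ] (F 0 * ind 0 i + F 1 * ind 1 i + F 2 * ind 2 i)
    ≡⟨ ∑-distrib-+ (λ i → F 0 * ind 0 i + F 1 * ind 1 i) (λ i → F 2 * ind 2 i) ⟩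
  ∑[ i < n ] (F 0 * ind 0 i + F 1 * ind 1 i) + ∑[ i < n ] (F 2 * ind 2 i)
    ≡⟨ cong (_+ ∑[ i < n ] (F 2 * ind 2 i)) (∑-distrib-+ (λ i → F 0 * ind 0 i) (λ i → F 1 * ind 1 i)) ⟩
  ∑[ i < n ] (F 0 * ind 0 i) + ∑[ i < n ] (F 1 * ind 1 i) + ∑[ i < n ] (F 2 * ind 2 i)
    ≡⟨ cong₂ _+_ (cong₂ _+_ (weighted 0) (weighted 1)) (weighted 2) ⟩
  F 0 * mult h 0 + F 1 * mult h 1 + F 2 * mult h 2 ∎
  where
  ind : ℕ → Fin n → ℕ
  ind j i = 𝟙 (h i ≡ᵇ j)
  weighted : ∀ j → ∑[ i < n ] (F j * ind j i) ≡ F j * mult h j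
  weighted j = trans (sym (*-distribˡ-sum (F j) (ind j))) (cong (F j *_) (sym (count≡sum (λ i → h i ≡ᵇ j))))

vandermonde₃ : ∀ {a b c a′ b′ c′ : ℕ} →
               a + b + c ≡ a′ + b′ + c′ → b + 2 * c ≡ b′ + 2 * c′ → b + 4 * c ≡ b′ + 4 * c′ →
               a ≡ a′ × b ≡ b′ × c ≡ c′
vandermonde₃ {a} {b} {c} {a′} {b′} {c′} e₀ e₁ e₂ = a≡a′ , b≡b′ , c≡c′
  where
  split-4 : ∀ x y → x + 4 * y ≡ (x + 2 * y) + 2 * y
  split-4 = solve-∀
  c≡c′ : c ≡ c′
  c≡c′ = *-cancelˡ-≡ c c′ 2 (+-cancelˡ-≡ (b′ + 2 * c′) (2 * c) (2 * c′) (begin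
    b′ + 2 * c′ + 2 * c   ≡⟨ cong (_+ 2 * c) (sym e₁) ⟩
    b + 2 * c + 2 * c     ≡⟨ sym (split-4 b c) ⟩
    b + 4 * c             ≡⟨ e₂ ⟩
    b′ + 4 * c′           ≡⟨ split-4 b′ c′ ⟩
    b′ + 2 * c′ + 2 * c′  ∎))
  b≡b′ : b ≡ b′
  b≡b′ = +-cancelʳ-≡ (2 * c′) b b′ (trans (sym (cong (λ t → b + 2 * t) c≡c′)) e₁)
  a≡a′ : a ≡ a′
  a≡a′ = +-cancelʳ-≡ b′ a a′ (+-cancelʳ-≡ c′ (a + b′) (a′ + b′)
           (trans (cong₂ (λ u w → a + u + w) (sym b≡b′) (sym c≡c′)) e₀))

two-moments-determine : ∀ {n} (h h′ : Fin n → ℕ) → (∀ i → h i ≤ 2) → (∀ i → h′ i ≤ 2) →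
                        sum h ≡ sum h′ → ∑[ i < n ] (h i * h i) ≡ ∑[ i < n ] (h′ i * h′ i) →
                        ∀ j → mult h j ≡ mult h′ j
two-moments-determine {n} h h′ h≤2 h′≤2 Σ≡ Σ²≡ j = begin
  mult h j                                              ≡⟨ count≡sum (λ i → h i ≡ᵇ j) ⟩
  ∑[ i < n ] F (h i)                                    ≡⟨ sum-by-values F h h≤2 ⟩
  F 0 * mult h 0 + F 1 * mult h 1 + F 2 * mult h 2      ≡⟨ cong₂ _+_ (cong₂ _+_ (cong (F 0 *_) m₀) (cong (F 1 *_) m₁))
                                                                     (cong (F 2 *_) m₂) ⟩
  F 0 * mult h′ 0 + F 1 * mult h′ 1 + F 2 * mult h′ 2   ≡⟨ sym (sum-by-values F h′ h′≤2) ⟩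
  ∑[ i < n ] F (h′ i)                                   ≡⟨ sym (count≡sum (λ i → h′ i ≡ᵇ j)) ⟩
  mult h′ j                                             ∎
  where
  F : ℕ → ℕ
  F a = 𝟙 (a ≡ᵇ j)
  same-statistic : ∀ (G : ℕ → ℕ) → ∑[ i < n ] G (h i) ≡ ∑[ i < n ] G (h′ i) →
            G 0 * mult h 0 + G 1 * mult h 1 + G 2 * mult h 2
            ≡ G 0 * mult h′ 0 + G 1 * mult h′ 1 + G 2 * mult h′ 2
  same-statistic G ΣG≡ = trans (sym (sum-by-values G h h≤2)) (trans ΣG≡ (sum-by-values G h′ h′≤2))
  count-form : ∀ x y z → 1 * x + 1 * y + 1 * z ≡ x + y + z
  count-form = solve-∀
  sum-form : ∀ y z → 1 * y + 2 * z ≡ y + 2 * z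
  sum-form = solve-∀
  square-form : ∀ y z → 1 * y + 4 * z ≡ y + 4 * z
  square-form = solve-∀
  moments : mult h 0 ≡ mult h′ 0 × mult h 1 ≡ mult h′ 1 × mult h 2 ≡ mult h′ 2
  moments = vandermonde₃
    (trans (sym (count-form (mult h 0) (mult h 1) (mult h 2)))
      (trans (same-statistic (λ _ → 1) refl) (count-form (mult h′ 0) (mult h′ 1) (mult h′ 2))))
    (trans (sym (sum-form (mult h 1) (mult h 2)))
      (trans (same-statistic (λ a → a) Σ≡) (sum-form (mult h′ 1) (mult h′ 2))))
    (trans (sym (square-form (mult h 1) (mult h 2)))
      (trans (same-statistic (λ a → a * a) Σ²≡) (square-form (mult h′ 1) (mult h′ 2))))
  m₀ : mult h 0 ≡ mult h′ 0
  m₀ = proj₁ moments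
  m₁ : mult h 1 ≡ mult h′ 1
  m₁ = proj₁ (proj₂ moments)
  m₂ : mult h 2 ≡ mult h′ 2
  m₂ = proj₂ (proj₂ moments)

square-fixed⇒≤1 : ∀ a → a ≡ a * a → a ≤ 1
square-fixed⇒≤1 0 _ = z≤n
square-fixed⇒≤1 1 _ = s≤s z≤n
square-fixed⇒≤1 (suc (suc a)) a≡a² with +-cancelˡ-≡ (suc (suc a)) 0 _ (trans (+-identityʳ _) a≡a²)
... | ()

n≤n*n : ∀ a → a ≤ a * a
n≤n*n zero    = z≤n
n≤n*n (suc a) = m≤m*n (suc a) (suc a)

-- (h - l)² + 2lh = h² + l², with the distance ∣ h - l ∣ in place of h - l.
gap-identity : ∀ h l → ∣ h - l ∣ * ∣ h - l ∣ + 2 * l * h ≡ h * h + l * l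
gap-identity zero    l       = left-zero l
  where
  left-zero : ∀ l → l * l + 2 * l * 0 ≡ 0 * 0 + l * l
  left-zero = solve-∀
gap-identity (suc h) zero    = right-zero h
  where
  right-zero : ∀ h → suc h * suc h + 2 * 0 * suc h ≡ suc h * suc h + 0 * 0
  right-zero = solve-∀
gap-identity (suc h) (suc l) = begin
  d * d + 2 * suc l * suc h            ≡⟨ expand-left d h l ⟩
  d * d + 2 * l * h + (2 * h + 2 * l + 2) ≡⟨ cong (_+ (2 * h + 2 * l + 2)) (gap-identity h l) ⟩
  h * h + l * l + (2 * h + 2 * l + 2)  ≡⟨ expand-right h l ⟩
  suc h * suc h + suc l * suc l        ∎
  where
  d : ℕ
  d = ∣ h - l ∣
  expand-left : ∀ d h l → d * d + 2 * suc l * suc h ≡ d * d + 2 * l * h + (2 * h + 2 * l + 2)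
  expand-left = solve-∀
  expand-right : ∀ h l → h * h + l * l + (2 * h + 2 * l + 2) ≡ suc h * suc h + suc l * suc l
  expand-right = solve-∀

am-gm : ∀ h l → 2 * l * h ≤ h * h + l * l
am-gm h l = ≤-trans (m≤n+m (2 * l * h) (∣ h - l ∣ * ∣ h - l ∣)) (≤-reflexive (gap-identity h l))

am-gm-equality : ∀ h l → 2 * l * h ≡ h * h + l * l → h ≡ l
am-gm-equality h l tight = ∣m-n∣≡0⇒m≡n (reduce (m*n≡0⇒m≡0∨n≡0 ∣ h - l ∣ gap²≡0))
  where
  gap²≡0 : ∣ h - l ∣ * ∣ h - l ∣ ≡ 0
  gap²≡0 = +-cancelʳ-≡ (2 * l * h) _ 0 (trans (gap-identity h l) (sym tight))

module BlockProfile {v n r k lam : ℕ} (D : BlockDesign v (suc n) r k lam) where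
  open DesignMoments D

  B : Fin (suc n) → Subset v
  B = block D

  profile : Fin (suc n) → Fin n → ℕ
  profile s i = ∣ B s ∩ B (punchIn s i) ∣

  ∣B∩B∣≡k : ∀ s → ∣ B s ∩ B s ∣ ≡ k
  ∣B∩B∣≡k s = trans (cong ∣_∣ (∩-idem (B s))) (blockSize D s)

  sum-over-blocks : ∀ (F : ℕ → ℕ) s → ∑[ t < suc n ] F ∣ B s ∩ B t ∣ ≡ F k + ∑[ i < n ] F (profile s i)
  sum-over-blocks F s = trans (sum-remove {i = s} (λ t → F ∣ B s ∩ B t ∣))
                              (cong (λ a → F a + ∑[ i < n ] F (profile s i)) (∣B∩B∣≡k s))

  φ≡profile : ∀ s j → φ D (B s) j ≡ 𝟙 (k ≡ᵇ toℕ j) + mult (profile s) (toℕ j)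
  φ≡profile s j = begin
    φ D (B s) j                                              ≡⟨ count≡sum (λ t → ∣ B s ∩ B t ∣ ≡ᵇ toℕ j) ⟩
    ∑[ t < suc n ] 𝟙 (∣ B s ∩ B t ∣ ≡ᵇ toℕ j)                ≡⟨ sum-over-blocks (λ a → 𝟙 (a ≡ᵇ toℕ j)) s ⟩
    𝟙 (k ≡ᵇ toℕ j) + ∑[ i < n ] 𝟙 (profile s i ≡ᵇ toℕ j)    ≡⟨ cong (𝟙 (k ≡ᵇ toℕ j) +_)
                                                                 (sym (count≡sum (λ i → profile s i ≡ᵇ toℕ j))) ⟩
    𝟙 (k ≡ᵇ toℕ j) + mult (profile s) (toℕ j)                ∎

  self-friend-from-profiles : (∀ s t j → mult (profile s) j ≡ mult (profile t) j) → SelfFriend D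
  self-friend-from-profiles same s t j =
    trans (φ≡profile s j) (trans (cong (𝟙 (k ≡ᵇ toℕ j) +_) (same s t (toℕ j))) (sym (φ≡profile t j)))

  profile-sum : ∀ s → k + sum (profile s) ≡ k * r
  profile-sum s = trans (sym (sum-over-blocks (λ a → a) s))
                        (trans (moment₁ (B s)) (cong (_* r) (blockSize D s)))

  profile-sum-sq : ∀ s → k * k + ∑[ i < n ] (profile s i * profile s i) + k * lam ≡ k * k * lam + k * r
  profile-sum-sq s = trans (cong (_+ k * lam) (sym (sum-over-blocks (λ a → a * a) s)))
    (subst (λ m → ∑[ t < suc n ] (∣ B s ∩ B t ∣ * ∣ B s ∩ B t ∣) + m * lam ≡ m * m * lam + m * r)
           (blockSize D s) (moment₂ (B s)))

  distinct-blocks : ∀ s t → s ≢ t → ∣ B s ∩ B t ∣ ≢ k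
  distinct-blocks s t s≢t meet = s≢t (simple D (trans (sym ∩≡Bs) ∩≡Bt))
    where
    ∩≡Bs : B s ∩ B t ≡ B s
    ∩≡Bs = ⊆-∣≡∣⇒≡ (p∩q⊆p (B s) (B t)) (trans meet (sym (blockSize D s)))
    ∩≡Bt : B s ∩ B t ≡ B t
    ∩≡Bt = ⊆-∣≡∣⇒≡ (p∩q⊆q (B s) (B t)) (trans meet (sym (blockSize D t)))

  self-friend-if-profile≤2 : (∀ s i → profile s i ≤ 2) → SelfFriend D
  self-friend-if-profile≤2 ≤2 = self-friend-from-profiles (λ s t →
    two-moments-determine (profile s) (profile t) (≤2 s) (≤2 t) (same-sum s t) (same-sum-sq s t))
    where
    same-sum : ∀ s t → sum (profile s) ≡ sum (profile t)
    same-sum s t = +-cancelˡ-≡ k _ _ (trans (profile-sum s) (sym (profile-sum t)))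
    same-sum-sq : ∀ s t → ∑[ i < n ] (profile s i * profile s i) ≡ ∑[ i < n ] (profile t i * profile t i)
    same-sum-sq s t = +-cancelˡ-≡ (k * k) _ _ (+-cancelʳ-≡ (k * lam) _ _
                        (trans (profile-sum-sq s) (sym (profile-sum-sq t))))

  -- Case λ = 1: the profile sum equals the sum of squares, so every entry
  -- equals its square and is 0 or 1.
  self-friend-if-λ≡1 : lam ≡ 1 → SelfFriend D
  self-friend-if-λ≡1 refl = self-friend-if-profile≤2 (λ s i →
    m≤n⇒m≤1+n (square-fixed⇒≤1 (profile s i) (sum-mono-≡ (λ i → n≤n*n (profile s i)) (sum≡sum-sq s) i)))
    where
    sum≡sum-sq : ∀ s → sum (profile s) ≡ ∑[ i < n ] (profile s i * profile s i)
    sum≡sum-sq s = sym (+-cancelˡ-≡ (k * k + k) _ _ (begin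
      k * k + k + Σ²               ≡⟨ regroup (k * k) k Σ² ⟩
      k * k + Σ² + k * 1           ≡⟨ profile-sum-sq s ⟩
      k * k * 1 + k * r            ≡⟨ cong (k * k * 1 +_) (sym (profile-sum s)) ⟩
      k * k * 1 + (k + sum (profile s)) ≡⟨ unregroup (k * k) k (sum (profile s)) ⟩
      k * k + k + sum (profile s)  ∎))
      where
      Σ² : ℕ
      Σ² = ∑[ i < n ] (profile s i * profile s i)
      regroup : ∀ a b c → a + b + c ≡ a + c + b * 1
      regroup = solve-∀
      unregroup : ∀ a b c → a * 1 + (b + c) ≡ a + b + c
      unregroup = solve-∀

  -- Case k = 3: two distinct blocks share at most 2 of their 3 points.
  self-friend-if-k≡3 : k ≡ 3 → SelfFriend D
  self-friend-if-k≡3 refl = self-friend-if-profile≤2 (λ s i →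
    s≤s⁻¹ (≤∧≢⇒< (at-most-3 s i) (distinct-blocks s (punchIn s i) (punchInᵢ≢i s i ∘ sym))))
    where
    at-most-3 : ∀ s i → profile s i ≤ 3
    at-most-3 s i = ≤-trans (∣p∩q∣≤∣q∣ (B s) (B (punchIn s i))) (≤-reflexive (blockSize D (punchIn s i)))

module SymmetricDesign {n r k lam : ℕ} (D : BlockDesign (suc n) (suc n) r k lam) where
  open DesignMoments D
  open BlockProfile D

  ∣⊤∩B∣≡k : ∀ s → ∣ ⊤ ∩ B s ∣ ≡ k
  ∣⊤∩B∣≡k s = trans (cong ∣_∣ (∩-identityˡ (B s))) (blockSize D s)

  -- Counting incidences with M = V gives b k = v r, hence k = r.
  k≡r : k ≡ r
  k≡r = *-cancelˡ-≡ k r (suc n) (begin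
    suc n * k                  ≡⟨ sym (sum-const (suc n) k) ⟩
    ∑[ s < suc n ] k           ≡⟨ sum-cong-≗ (λ s → sym (∣⊤∩B∣≡k s)) ⟩
    ∑[ s < suc n ] ∣ ⊤ ∩ B s ∣ ≡⟨ moment₁ ⊤ ⟩
    ∣ ⊤ {suc n} ∣ * r          ≡⟨ cong (_* r) (∣⊤∣≡n (suc n)) ⟩
    suc n * r                  ∎)

  -- The second moment with M = V gives k² = nλ + k.
  k²≡nλ+k : k * k ≡ n * lam + k
  k²≡nλ+k = +-cancelʳ-≡ lam (k * k) (n * lam + k)
    (trans (*-cancelˡ-≡ (k * k + lam) (suc n * lam + k) (suc n) scaled) (unfold n lam k))
    where
    v : ℕ
    v = suc n
    unfold : ∀ n l k → suc n * l + k ≡ n * l + k + l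
    unfold = solve-∀
    factor : ∀ v l k → v * v * l + v * k ≡ v * (v * l + k)
    factor = solve-∀
    scaled : v * (k * k + lam) ≡ v * (v * lam + k)
    scaled = begin
      v * (k * k + lam)
        ≡⟨ *-distribˡ-+ v (k * k) lam ⟩
      v * (k * k) + v * lam
        ≡⟨ cong (_+ v * lam) (sym (sum-const v (k * k))) ⟩
      ∑[ s < v ] (k * k) + v * lam
        ≡⟨ cong (_+ v * lam) (sum-cong-≗ (λ s → sym (cong (λ a → a * a) (∣⊤∩B∣≡k s)))) ⟩
      ∑[ s < v ] (∣ ⊤ ∩ B s ∣ * ∣ ⊤ ∩ B s ∣) + v * lam
        ≡⟨ subst (λ m → ∑[ s < v ] (∣ ⊤ ∩ B s ∣ * ∣ ⊤ ∩ B s ∣) + m * lam ≡ m * m * lam + m * r)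
                 (∣⊤∣≡n v) (moment₂ ⊤) ⟩
      v * v * lam + v * r
        ≡⟨ cong (λ a → v * v * lam + v * a) (sym k≡r) ⟩
      v * v * lam + v * k
        ≡⟨ factor v lam k ⟩
      v * (v * lam + k) ∎

  profile-sum≡nλ : ∀ s → sum (profile s) ≡ n * lam
  profile-sum≡nλ s = +-cancelˡ-≡ k _ _ (begin
    k + sum (profile s)  ≡⟨ profile-sum s ⟩
    k * r                ≡⟨ cong (k *_) (sym k≡r) ⟩
    k * k                ≡⟨ k²≡nλ+k ⟩
    n * lam + k          ≡⟨ +-comm (n * lam) k ⟩
    k + n * lam          ∎)

  profile-sum-sq≡nλ² : ∀ s → ∑[ i < n ] (profile s i * profile s i) ≡ n * lam * lam
  profile-sum-sq≡nλ² s = +-cancelˡ-≡ (k * k + k * lam) _ _ (begin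
    k * k + k * lam + Σ²            ≡⟨ regroup (k * k) (k * lam) Σ² ⟩
    k * k + Σ² + k * lam            ≡⟨ profile-sum-sq s ⟩
    k * k * lam + k * r             ≡⟨ cong (λ a → k * k * lam + k * a) (sym k≡r) ⟩
    k * k * lam + k * k             ≡⟨ cong (λ a → a * lam + k * k) k²≡nλ+k ⟩
    (n * lam + k) * lam + k * k     ≡⟨ expand n lam k (k * k) ⟩
    k * k + k * lam + n * lam * lam ∎)
    where
    Σ² : ℕ
    Σ² = ∑[ i < n ] (profile s i * profile s i)
    regroup : ∀ a b c → a + b + c ≡ a + c + b
    regroup = solve-∀
    expand : ∀ n l k K → (n * l + k) * l + K ≡ K + k * l + n * l * l
    expand = solve-∀

  -- Σ 2λh = 2nλ² = Σ (h² + λ²), so equality holds in every 2λh ≤ h² + λ².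
  profile≡λ : ∀ s i → profile s i ≡ lam
  profile≡λ s i = am-gm-equality (profile s i) lam
    (sum-mono-≡ (λ i → am-gm (profile s i) lam) sums-agree i)
    where
    double : ∀ n l → 2 * l * (n * l) ≡ n * l * l + n * (l * l)
    double = solve-∀
    sums-agree : ∑[ i < n ] (2 * lam * profile s i) ≡ ∑[ i < n ] (profile s i * profile s i + lam * lam)
    sums-agree = begin
      ∑[ i < n ] (2 * lam * profile s i)
        ≡⟨ sym (*-distribˡ-sum (2 * lam) (profile s)) ⟩
      2 * lam * sum (profile s)
        ≡⟨ cong (2 * lam *_) (profile-sum≡nλ s) ⟩
      2 * lam * (n * lam)
        ≡⟨ double n lam ⟩
      n * lam * lam + n * (lam * lam)
        ≡⟨ sym (cong₂ _+_ (profile-sum-sq≡nλ² s) (sum-const n (lam * lam))) ⟩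
      ∑[ i < n ] (profile s i * profile s i) + ∑[ i < n ] (lam * lam)
        ≡⟨ sym (∑-distrib-+ (λ i → profile s i * profile s i) (λ _ → lam * lam)) ⟩
      ∑[ i < n ] (profile s i * profile s i + lam * lam) ∎

  self-friend : SelfFriend D
  self-friend = self-friend-from-profiles (λ s t j →
    count-cong (λ i → cong (_≡ᵇ j) (trans (profile≡λ s i) (sym (profile≡λ t i)))))

-- A design without blocks is vacuously friends with itself; otherwise each
-- hypothesis selects one of the cases above.
theorem1 : ∀ {v b r k lam : ℕ} (D : BlockDesign v b r k lam) →
    (lam ≡ 1) ⊎ (k ≡ 3) ⊎ (b ≡ v) → SelfFriend D
theorem1 {b = zero}  D _                  ()
theorem1 {b = suc n} D (inj₁ lam≡1)       = BlockProfile.self-friend-if-λ≡1 D lam≡1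
theorem1 {b = suc n} D (inj₂ (inj₁ k≡3))  = BlockProfile.self-friend-if-k≡3 D k≡3
theorem1 {b = suc n} D (inj₂ (inj₂ refl)) = SymmetricDesign.self-friend D
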